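{- Let $\beta$ be an algebraic number of degree $n\geq 5$ such that $\beta^{k} \notin \mathbb{Q}$ for every non-zero integer $k$. Let $\beta_{1},\dots,\beta_{n}$ be the conjugates of $\beta$, and suppose that $\mathfrak{A}_{n} \subseteq \mathrm{Gal}(\mathbb{Q}(\beta_{1},\dots,\beta_{n})/\mathbb{Q})$. Then, for all $v_{1},\dots,v_{n} \in \mathbb{Z}$, not all equal, the product $\beta_{1}^{v_{1}} \cdots \beta_{n}^{v_{n}}$ is not a root of unity.
   Context: The inclusion $\mathfrak{A}_{n} \subseteq \mathrm{Gal}(\mathbb{Q}(\beta_{1},\dots,\beta_{n})/\mathbb{Q})$ is understood via the identification of a permutation $\sigma$ of $\{1,\dots,n\}$ with the automorphism sending $\beta_i\mapsto\beta_{\sigma(i)}$, i.e. every even permutation of the roots is induced by a field automorphism. -}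

module Defs where

open import Level using (Level; _⊔_) renaming (suc to lsuc)
open import Data.Nat as ℕ using (ℕ; zero; suc; _%_)
open import Data.Integer as ℤ using (ℤ; +_; -[1+_])
open import Data.Rational as ℚ using (ℚ)
import Data.Rational.Properties as ℚP
open import Data.Fin as Fin using (Fin)
open import Data.Fin.Permutation using (Permutation′; _⟨$⟩ʳ_)
open import Data.List using (List; []; _∷_; concatMap; map; allFin; foldr)
open import Data.Nat.ListAction using (sum)
open import Data.Bool using (if_then_else_; _∧_)
open import Data.Product using (Σ; ∃; ∃-syntax; _×_; _,_)
open import Relation.Nullary using (¬_)
open import Relation.Nullary.Decidable using (⌊_⌋)
open import Relation.Binary.PropositionalEquality using (_≡_; _≢_)
open import Algebra.Bundles using (CommutativeRing)
open import Algebra.Morphism.Structures using (module RingMorphisms)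

record Field (c ℓ : Level) : Set (lsuc (c ⊔ ℓ)) where
  field
    commutativeRing : CommutativeRing c ℓ
  open CommutativeRing commutativeRing public
  field
    _⁻¹      : Carrier → Carrier
    0≉1      : ¬ (0# ≈ 1#)
    ⁻¹-inverse : ∀ x → ¬ (x ≈ 0#) → x * (x ⁻¹) ≈ 1#

-- A field K together with a ring homomorphism ι : ℚ → K
-- (i.e. a field extension of ℚ; such ι is unique and injective).

record ExtensionOfℚ (c ℓ : Level) : Set (lsuc (c ⊔ ℓ)) where
  field
    K : Field c ℓ
  open Field K public
  field
    ι      : ℚ → Carrier
    ι-hom  : RingMorphisms.IsRingHomomorphism
               (CommutativeRing.rawRing ℚP.+-*-commutativeRing) rawRing ι

module _ {c ℓ : Level} (E : ExtensionOfℚ c ℓ) where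
  open ExtensionOfℚ E

  _^ⁿ_ : Carrier → ℕ → Carrier
  x ^ⁿ zero  = 1#
  x ^ⁿ suc m = x * (x ^ⁿ m)

  -- integer powers (meaningful for x ≉ 0)
  _^ᶻ_ : Carrier → ℤ → Carrier
  x ^ᶻ (+ m)     = x ^ⁿ m
  x ^ᶻ -[1+ m ]  = (x ^ⁿ suc m) ⁻¹

  IsRational : Carrier → Set ℓ
  IsRational x = ∃[ q ] (x ≈ ι q)

  IsRootOfUnity : Carrier → Set ℓ
  IsRootOfUnity x = ∃[ m ] (m ≢ 0 × (x ^ⁿ m) ≈ 1#)

  evalMonic : (n : ℕ) → (Fin n → ℚ) → Carrier → Carrier
  evalMonic n a x =
    (x ^ⁿ n) + foldr (λ i acc → (ι (a i) * (x ^ⁿ Fin.toℕ i)) + acc) 0# (allFin n)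

  evalPoly : (m : ℕ) → (Fin m → ℚ) → Carrier → Carrier
  evalPoly m b x = foldr (λ i acc → (ι (b i) * (x ^ⁿ Fin.toℕ i)) + acc) 0# (allFin m)

  IsMinimalPolynomial : (n : ℕ) → (Fin n → ℚ) → Carrier → Set ℓ
  IsMinimalPolynomial n a β =
    (evalMonic n a β ≈ 0#) ×
    (∀ (b : Fin n → ℚ) → evalPoly n b β ≈ 0# → ∀ i → b i ≡ ℚ.0ℚ)

  data InGenSubfield {n : ℕ} (β : Fin n → Carrier) : Carrier → Set (c ⊔ ℓ) where
    base  : ∀ q → InGenSubfield β (ι q)
    gen   : ∀ i → InGenSubfield β (β i)
    plus  : ∀ {x y} → InGenSubfield β x → InGenSubfield β y → InGenSubfield β (x + y)
    times : ∀ {x y} → InGenSubfield β x → InGenSubfield β y → InGenSubfield β (x * y)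
    neg   : ∀ {x} → InGenSubfield β x → InGenSubfield β (- x)
    inv   : ∀ {x} → InGenSubfield β x → ¬ (x ≈ 0#) → InGenSubfield β (x ⁻¹)
    resp  : ∀ {x y} → x ≈ y → InGenSubfield β x → InGenSubfield β y

  record IsAutomorphismOfGenSubfield {n : ℕ} (β : Fin n → Carrier)
      (φ : Σ Carrier (InGenSubfield β) → Σ Carrier (InGenSubfield β))
      : Set (c ⊔ ℓ) where
    private
      L = Σ Carrier (InGenSubfield β)
      val : L → Carrier
      val (x , _) = x
    field
      φ-cong   : ∀ (x y : L) → val x ≈ val y → val (φ x) ≈ val (φ y)
      φ-+      : ∀ (x y : L) → val (φ (val x + val y , plus (Σ.proj₂ x) (Σ.proj₂ y)))
                                   ≈ val (φ x) + val (φ y)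
      φ-*      : ∀ (x y : L) → val (φ (val x * val y , times (Σ.proj₂ x) (Σ.proj₂ y)))
                                   ≈ val (φ x) * val (φ y)
      φ-1      : val (φ (1# , resp (ExtensionOfℚ.ι-hom E .RingMorphisms.IsRingHomomorphism.1#-homo) (base ℚ.1ℚ))) ≈ 1#
      φ-inj    : ∀ (x y : L) → val (φ x) ≈ val (φ y) → val x ≈ val y
      φ-surj   : ∀ (y : L) → ∃[ x ] (val (φ x) ≈ val y)

  -- σ ∈ Gal(ℚ(β₁,…,βₙ)/ℚ) in the sense of the paper: there is an
  -- automorphism of ℚ(β₁,…,βₙ) sending βᵢ to β_{σ(i)} for all i.
  InducedByAutomorphism : {n : ℕ} → (β : Fin n → Carrier) → Permutation′ n → Set (c ⊔ ℓ)
  InducedByAutomorphism {n} β σ =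
    ∃[ φ ] (IsAutomorphismOfGenSubfield β φ ×
            (∀ i → Σ.proj₁ (φ (β i , gen i)) ≈ β (σ ⟨$⟩ʳ i)))

  prodPow : (n : ℕ) → (Fin n → Carrier) → (Fin n → ℤ) → Carrier
  prodPow n β v = foldr (λ i acc → (β i ^ᶻ v i) * acc) 1# (allFin n)

inversions : {n : ℕ} → Permutation′ n → ℕ
inversions {n} σ =
  sum (concatMap (λ i → map (λ j →
        if ⌊ i Fin.<? j ⌋ ∧ ⌊ (σ ⟨$⟩ʳ j) Fin.<? (σ ⟨$⟩ʳ i) ⌋ then 1 else 0)
      (allFin n)) (allFin n))

IsEven : {n : ℕ} → Permutation′ n → Set
IsEven σ = inversions σ % 2 ≡ 0

{-# OPTIONS --safe #-}
-- The βᵢ are non-zero, and for a fixed order m the exponent vectors w with (∏ βᵢ^wᵢ)^m = 1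
-- form a group Λ.  Even permutations of the roots are induced by field automorphisms, so Λ is
-- stable under the 3-cycles of consecutive coordinates.  If v ∈ Λ is not constant, three
-- consecutive coordinates x, y, z of v are not all equal, and v minus its image under their
-- 3-cycle is u = (x − z, y − x, z − y) on them.  Viewing u as an Eisenstein integer on which
-- the 3-cycle acts as ω, the combination (y − x)·u − (z − y)·ωu is e·(1, −1, 0), where e is
-- minus the norm of u and hence non-zero.  Moving this vector around with 3-cycles shows that
-- all βᵢ have the same N-th power C, N = |e|·m.  Reducing X^N modulo the polynomial of β gives
-- r ∈ ℚ[X] of degree < n with r(βᵢ) = C at the n distinct roots βᵢ; so r is the constant C,
-- and β^N = C is rational, which is excluded.
module Submission where

open import Defs
open import Level using (_⊔_)
open import Function using (_∘_)
open import Data.Bool using (false; if_then_else_; _∧_)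
open import Data.Nat as ℕ using (ℕ; zero; suc; _≤_; s≤s)
import Data.Nat.Properties as ℕP
import Data.Nat.ListAction as ℕL
open import Data.Nat.ListAction.Properties using (sum-++)
open import Data.Integer as ℤ using (ℤ; +_; -[1+_]; 0ℤ; _⊖_)
import Data.Integer.Properties as ℤP
open import Data.Integer.Tactic.RingSolver using (solve-∀)
open import Data.Rational as ℚ using (ℚ)
import Data.Rational.Properties as ℚP
open import Data.Fin as Fin using (Fin; zero; suc; toℕ; inject₁)
import Data.Fin.Properties as FinP
open import Data.Fin.Permutation using (Permutation′; permutation; lift₀; _⟨$⟩ʳ_; _⟨$⟩ˡ_; inverseˡ)
open import Data.List as List using (List; allFin; concatMap)
import Data.List.Properties as ListP
open import Data.Vec.Functional using (_∷_; head; tail; init; last)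
import Data.Maybe as Maybe
open import Data.Product using (Σ; ∃-syntax; _×_; _,_; proj₁; proj₂)
open import Data.Sum using (reduce; [_,_]′)
open import Relation.Nullary using (¬_; yes; no; contradiction)
open import Relation.Nullary.Decidable using (⌊_⌋; dec⇒maybe)
open import Relation.Binary.Definitions using (DecidableEquality; WeaklyDecidable)
open import Relation.Binary.PropositionalEquality as ≡ using (_≡_; _≢_)
open import Algebra.Bundles using (Monoid; CommutativeRing)
open import Algebra.Morphism.Structures using (module RingMorphisms)
import Algebra.Properties.CommutativeMonoid.Sum as CommutativeMonoidSum
import Algebra.Properties.CommutativeSemiring.Exp as CommutativeSemiringExp
import Algebra.Properties.Group as GroupProperties
import Algebra.Properties.Semiring.Sum as SemiringSum
open import Algebra.Solver.Ring.AlmostCommutativeRing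
  using (AlmostCommutativeRing; fromCommutativeRing; _-Raw-AlmostCommutative⟶_; Induced-equivalence)
import Algebra.Solver.Ring as RingSolver

module _ {a ℓ} (M : Monoid a ℓ) where
  open Monoid M using (Carrier; _∙_; ε)
  open import Algebra.Properties.Monoid.Sum M using (sum)

  foldr-tabulate≡sum : ∀ {b} {A : Set b} {n} (f : A → Carrier) (g : Fin n → A) →
                       List.foldr (λ x acc → f x ∙ acc) ε (List.tabulate g) ≡ sum (f ∘ g)
  foldr-tabulate≡sum {n = zero}  f g = ≡.refl
  foldr-tabulate≡sum {n = suc n} f g = ≡.cong (f (g zero) ∙_) (foldr-tabulate≡sum f (g ∘ suc))

module ThreeCycles where
  open ≡ using (refl; cong; cong₂)
  open import Data.List using ([]; _∷_)

  private module ℕΣ = CommutativeMonoidSum ℕP.+-0-commutativeMonoid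
  open ℕΣ using (sum-syntax)

  sum-concatMap : ∀ {a} {A : Set a} (f : A → List ℕ) xs →
                  ℕL.sum (concatMap f xs) ≡ ℕL.sum (List.map (ℕL.sum ∘ f) xs)
  sum-concatMap f []       = refl
  sum-concatMap f (x ∷ xs) = ≡.trans (sum-++ (f x) _) (cong (ℕL.sum (f x) ℕ.+_) (sum-concatMap f xs))

  sum-map-allFin : ∀ {n} (f : Fin n → ℕ) → ℕL.sum (List.map f (allFin n)) ≡ ∑[ i < n ] f i
  sum-map-allFin {n} f = ≡.trans (cong ℕL.sum (ListP.map-tabulate (λ i → i) f))
                                 (foldr-tabulate≡sum ℕP.+-0-monoid (λ x → x) f)

  ∑-zero : ∀ {n} {f : Fin n → ℕ} → (∀ i → f i ≡ 0) → ∑[ i < n ] f i ≡ 0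
  ∑-zero {n} f≗0 = ≡.trans (ℕΣ.sum-cong-≗ f≗0) (ℕΣ.sum-replicate-zero n)

  inverted : ∀ {n} → Permutation′ n → Fin n → Fin n → ℕ
  inverted σ i j = if ⌊ i Fin.<? j ⌋ ∧ ⌊ (σ ⟨$⟩ʳ j) Fin.<? (σ ⟨$⟩ʳ i) ⌋ then 1 else 0

  inversions≡∑∑ : ∀ {n} (σ : Permutation′ n) → inversions σ ≡ ∑[ i < n ] ∑[ j < n ] inverted σ i j
  inversions≡∑∑ {n} σ = ≡.trans (sum-concatMap row (allFin n))
    (≡.trans (sum-map-allFin (ℕL.sum ∘ row)) (ℕΣ.sum-cong-≗ (sum-map-allFin ∘ inverted σ)))
    where
    row : Fin n → List ℕ
    row i = List.map (inverted σ i) (allFin n)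

  <?-suc : ∀ {n} (i j : Fin n) → ⌊ suc i Fin.<? suc j ⌋ ≡ ⌊ i Fin.<? j ⌋
  <?-suc i j with i Fin.<? j | suc i Fin.<? suc j
  ... | yes _   | yes _     = refl
  ... | no  _   | no  _     = refl
  ... | yes i<j | no  i+1≮j+1 = contradiction (s≤s i<j) i+1≮j+1
  ... | no  i≮j | yes i+1<j+1 = contradiction (ℕP.≤-pred i+1<j+1) i≮j

  <?-asym : ∀ {n} (i j : Fin n) → ⌊ i Fin.<? j ⌋ ∧ ⌊ j Fin.<? i ⌋ ≡ false
  <?-asym i j with i Fin.<? j | j Fin.<? i
  ... | yes i<j | yes j<i = contradiction j<i (FinP.<-asym i<j)
  ... | yes _   | no  _   = refl
  ... | no  _   | _       = refl

  inversions-lift₀ : ∀ {n} (σ : Permutation′ n) → inversions (lift₀ σ) ≡ inversions σ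
  inversions-lift₀ {n} σ = begin
    inversions (lift₀ σ)                                  ≡⟨ inversions≡∑∑ (lift₀ σ) ⟩
    ∑[ i < suc n ] ∑[ j < suc n ] inverted (lift₀ σ) i j  ≡⟨ cong₂ ℕ._+_ (∑-zero {n} (λ _ → refl)) (ℕΣ.sum-cong-≗ λ i → ℕΣ.sum-cong-≗ (inverted-lift₀ i)) ⟩
    ∑[ i < n ] ∑[ j < n ] inverted σ i j                  ≡⟨ inversions≡∑∑ σ ⟨
    inversions σ                                          ∎
    where
    open ≡.≡-Reasoning
    inverted-lift₀ : ∀ i j → inverted (lift₀ σ) (suc i) (suc j) ≡ inverted σ i j
    inverted-lift₀ i j = cong₂ (λ p q → if p ∧ q then 1 else 0) (<?-suc i j) (<?-suc (σ ⟨$⟩ʳ j) (σ ⟨$⟩ʳ i))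

  rotate-head : ∀ {m} → Fin (3 ℕ.+ m) → Fin (3 ℕ.+ m)
  rotate-head zero                = suc zero
  rotate-head (suc zero)          = suc (suc zero)
  rotate-head (suc (suc zero))    = zero
  rotate-head (suc (suc (suc i))) = suc (suc (suc i))

  rotate-head⁻¹ : ∀ {m} → Fin (3 ℕ.+ m) → Fin (3 ℕ.+ m)
  rotate-head⁻¹ zero                = suc (suc zero)
  rotate-head⁻¹ (suc zero)          = zero
  rotate-head⁻¹ (suc (suc zero))    = suc zero
  rotate-head⁻¹ (suc (suc (suc i))) = suc (suc (suc i))

  rotate-head-inverseʳ : ∀ {m} (i : Fin (3 ℕ.+ m)) → rotate-head (rotate-head⁻¹ i) ≡ i
  rotate-head-inverseʳ zero                = refl
  rotate-head-inverseʳ (suc zero)          = refl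
  rotate-head-inverseʳ (suc (suc zero))    = refl
  rotate-head-inverseʳ (suc (suc (suc i))) = refl

  rotate-head-inverseˡ : ∀ {m} (i : Fin (3 ℕ.+ m)) → rotate-head⁻¹ (rotate-head i) ≡ i
  rotate-head-inverseˡ zero                = refl
  rotate-head-inverseˡ (suc zero)          = refl
  rotate-head-inverseˡ (suc (suc zero))    = refl
  rotate-head-inverseˡ (suc (suc (suc i))) = refl

  cycle₀ : ∀ {m} → Permutation′ (3 ℕ.+ m)
  cycle₀ = permutation rotate-head rotate-head⁻¹ rotate-head-inverseʳ rotate-head-inverseˡ

  -- Only the pairs (0, 2) and (1, 2) are inverted: the first three rows of the sum contribute 1, 1, 0.
  inversions-cycle₀ : ∀ m → inversions (cycle₀ {m}) ≡ 2
  inversions-cycle₀ m = begin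
    inversions (cycle₀ {m})                         ≡⟨ inversions≡∑∑ (cycle₀ {m}) ⟩
    suc zeros ℕ.+ (suc zeros ℕ.+ (zeros ℕ.+ rest))  ≡⟨ cong (λ z → suc z ℕ.+ (suc z ℕ.+ (z ℕ.+ rest))) (ℕΣ.sum-replicate-zero m) ⟩
    2 ℕ.+ rest                                      ≡⟨ cong (2 ℕ.+_) (∑-zero λ i → ∑-zero (tail-uninverted i)) ⟩
    2                                               ∎
    where
    open ≡.≡-Reasoning
    3+ : Fin m → Fin (3 ℕ.+ m)
    3+ i = suc (suc (suc i))
    zeros rest : ℕ
    zeros = ∑[ j < m ] 0
    rest  = ∑[ i < m ] ∑[ j < m ] inverted (cycle₀ {m}) (3+ i) (3+ j)
    tail-uninverted : ∀ i j → inverted (cycle₀ {m}) (3+ i) (3+ j) ≡ 0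
    tail-uninverted i j = cong (λ b → if b then 1 else 0) (<?-asym (3+ i) (3+ j))

  rotate₃ : ∀ {m} → Fin m → Permutation′ (suc (suc m))
  rotate₃ {suc m} zero    = cycle₀
  rotate₃ {suc m} (suc i) = lift₀ (rotate₃ i)

  rotate₃-even : ∀ {m} (i : Fin m) → IsEven (rotate₃ i)
  rotate₃-even i = cong (ℕ._% 2) (inversions-rotate₃ i)
    where
    inversions-rotate₃ : ∀ {m} (i : Fin m) → inversions (rotate₃ i) ≡ 2
    inversions-rotate₃ {suc m} zero    = inversions-cycle₀ m
    inversions-rotate₃ {suc m} (suc i) = ≡.trans (inversions-lift₀ (rotate₃ i)) (inversions-rotate₃ i)

  unrotate : ℕ → ℕ → ℕ
  unrotate zero    0                   = 2
  unrotate zero    1                   = 0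
  unrotate zero    2                   = 1
  unrotate zero    (suc (suc (suc x))) = suc (suc (suc x))
  unrotate (suc k) zero                = zero
  unrotate (suc k) (suc x)             = suc (unrotate k x)

  toℕ-rotate₃⁻¹ : ∀ {m} (i : Fin m) j → toℕ (rotate₃ i ⟨$⟩ˡ j) ≡ unrotate (toℕ i) (toℕ j)
  toℕ-rotate₃⁻¹ {suc m} zero    zero                = refl
  toℕ-rotate₃⁻¹ {suc m} zero    (suc zero)          = refl
  toℕ-rotate₃⁻¹ {suc m} zero    (suc (suc zero))    = refl
  toℕ-rotate₃⁻¹ {suc m} zero    (suc (suc (suc j))) = refl
  toℕ-rotate₃⁻¹ {suc m} (suc i) zero                = refl
  toℕ-rotate₃⁻¹ {suc m} (suc i) (suc j)             = cong suc (toℕ-rotate₃⁻¹ i j)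

  rotate₃-middle : ∀ {m} (i : Fin m) → rotate₃ i ⟨$⟩ʳ suc (inject₁ i) ≡ suc (suc i)
  rotate₃-middle {suc m} zero    = refl
  rotate₃-middle {suc m} (suc i) = cong suc (rotate₃-middle i)

  adjacent-even : ∀ {m} (p : Fin (suc (suc m))) → ∃[ σ ] (IsEven {3 ℕ.+ m} σ × σ ⟨$⟩ʳ inject₁ p ≡ suc p)
  adjacent-even {m} zero    = rotate₃ {suc m} zero , rotate₃-even {suc m} zero , refl
  adjacent-even     (suc i) = rotate₃ i , rotate₃-even i , rotate₃-middle i

open ThreeCycles

module Adjacency where
  open ≡ using (refl; sym; trans)

  adjacent-transport : ∀ {a n} (Q : Fin (suc n) → Set a) →
                       (∀ p → Q (inject₁ p) → Q (suc p)) → (∀ p → Q (suc p) → Q (inject₁ p)) →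
                       ∀ i j → Q i → Q j
  adjacent-transport Q up down i j = from-zero Q up j ∘ to-zero Q down i
    where
    to-zero : ∀ {n} (Q : Fin (suc n) → Set _) → (∀ p → Q (suc p) → Q (inject₁ p)) → ∀ i → Q i → Q zero
    to-zero         Q down zero    = λ Qi → Qi
    to-zero {suc n} Q down (suc i) = down zero ∘ to-zero (Q ∘ suc) (down ∘ suc) i
    from-zero : ∀ {n} (Q : Fin (suc n) → Set _) → (∀ p → Q (inject₁ p) → Q (suc p)) → ∀ j → Q zero → Q j
    from-zero         Q up zero    = λ Q₀ → Q₀
    from-zero {suc n} Q up (suc j) = from-zero (Q ∘ suc) (up ∘ suc) j ∘ up zero

  adjacent-difference : ∀ {a n} {A : Set a} → DecidableEquality A → (v : Fin (suc n) → A) →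
                        (∃[ i ] ∃[ j ] v i ≢ v j) → ∃[ p ] v (inject₁ p) ≢ v (suc p)
  adjacent-difference {n = n} _≟_ v (i , j , vi≢vj) =
    FinP.¬∀⟶∃¬ n (λ p → v (inject₁ p) ≡ v (suc p)) (λ p → v (inject₁ p) ≟ v (suc p)) λ steps-equal →
      vi≢vj (sym (adjacent-transport (λ k → v k ≡ v i) (λ p → trans (sym (steps-equal p))) (λ p → trans (steps-equal p)) i j refl))

open Adjacency

-- Exponent vectors are indexed by ℕ rather than Fin n, so that a block of three values at
-- positions k, k + 1, k + 2 is defined by recursion on k; entries at positions ≥ n are ignored.
module ExponentVectors where
  open ≡ using (refl; cong; cong₂; sym; trans)

  extend : ∀ {n} → (Fin n → ℤ) → ℕ → ℤ
  extend {zero}  v x       = 0ℤ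
  extend {suc n} v zero    = v zero
  extend {suc n} v (suc x) = extend (v ∘ suc) x

  extend-toℕ : ∀ {n} (v : Fin n → ℤ) i → extend v (toℕ i) ≡ v i
  extend-toℕ v zero    = refl
  extend-toℕ v (suc i) = extend-toℕ (v ∘ suc) i

  extend-adjacent : ∀ {n} (v : Fin (suc n) → ℤ) p → v (inject₁ p) ≢ v (suc p) → extend v (toℕ p) ≢ extend v (suc (toℕ p))
  extend-adjacent v p vₚ≢vₚ₊₁ Vₚ≡Vₚ₊₁ =
    vₚ≢vₚ₊₁ (trans (sym (extend-toℕ v (inject₁ p))) (trans (cong (extend v) (FinP.toℕ-inject₁ p)) (trans Vₚ≡Vₚ₊₁ (extend-toℕ v (suc p)))))

  block : ℕ → ℤ → ℤ → ℤ → ℕ → ℤ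
  block zero    a b c 0                   = a
  block zero    a b c 1                   = b
  block zero    a b c 2                   = c
  block zero    a b c (suc (suc (suc x))) = 0ℤ
  block (suc k) a b c zero                = 0ℤ
  block (suc k) a b c (suc x)             = block k a b c x

  block-zipWith : ∀ (f : ℤ → ℤ → ℤ) → f 0ℤ 0ℤ ≡ 0ℤ → ∀ k {a b c a′ b′ c′} x →
                  f (block k a b c x) (block k a′ b′ c′ x) ≡ block k (f a a′) (f b b′) (f c c′) x
  block-zipWith f f00≡0 zero    0                   = refl
  block-zipWith f f00≡0 zero    1                   = refl
  block-zipWith f f00≡0 zero    2                   = refl
  block-zipWith f f00≡0 zero    (suc (suc (suc x))) = f00≡0
  block-zipWith f f00≡0 (suc k) zero                = f00≡0
  block-zipWith f f00≡0 (suc k) (suc x)             = block-zipWith f f00≡0 k x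

  block-unrotate : ∀ k a b c x → block k a b c (unrotate k x) ≡ block k c a b x
  block-unrotate zero    a b c 0                   = refl
  block-unrotate zero    a b c 1                   = refl
  block-unrotate zero    a b c 2                   = refl
  block-unrotate zero    a b c (suc (suc (suc x))) = refl
  block-unrotate (suc k) a b c zero                = refl
  block-unrotate (suc k) a b c (suc x)             = block-unrotate k a b c x

  block-suc : ∀ k b c x → block k 0ℤ b c x ≡ block (suc k) b c 0ℤ x
  block-suc zero    b c 0                         = refl
  block-suc zero    b c 1                         = refl
  block-suc zero    b c 2                         = refl
  block-suc zero    b c 3                         = refl
  block-suc zero    b c (suc (suc (suc (suc x)))) = refl
  block-suc (suc k) b c zero                      = refl
  block-suc (suc k) b c (suc x)                   = block-suc k b c x

  sub-unrotate≡block : ∀ k (V : ℕ → ℤ) x →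
                    V x ℤ.- V (unrotate k x) ≡ block k (V k ℤ.- V (2 ℕ.+ k)) (V (1 ℕ.+ k) ℤ.- V k) (V (2 ℕ.+ k) ℤ.- V (1 ℕ.+ k)) x
  sub-unrotate≡block zero    V 0                   = refl
  sub-unrotate≡block zero    V 1                   = refl
  sub-unrotate≡block zero    V 2                   = refl
  sub-unrotate≡block zero    V (suc (suc (suc x))) = ℤP.+-inverseʳ (V (suc (suc (suc x))))
  sub-unrotate≡block (suc k) V zero                = ℤP.+-inverseʳ (V zero)
  sub-unrotate≡block (suc k) V (suc x)             = sub-unrotate≡block k (V ∘ suc) x

  -- Minus the norm of the Eisenstein integer (y − x) − (z − y)ω.
  negNorm : ℤ → ℤ → ℤ → ℤ
  negNorm x y z = (y ℤ.- x) ℤ.* (x ℤ.- z) ℤ.- (z ℤ.- y) ℤ.* (z ℤ.- y)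

  *-self : ∀ i → i ℤ.* i ≡ + (ℤ.∣ i ∣ ℕ.* ℤ.∣ i ∣)
  *-self (+ zero)  = refl
  *-self (+ suc k) = refl
  *-self -[1+ k ]  = refl

  squares≡0 : ∀ i j k → i ℤ.* i ℤ.+ j ℤ.* j ℤ.+ k ℤ.* k ≡ 0ℤ → i ≡ 0ℤ × j ≡ 0ℤ × k ≡ 0ℤ
  squares≡0 i j k sum≡0 = ∣∣²≡0 i (ℕP.m+n≡0⇒m≡0 I (ℕP.m+n≡0⇒m≡0 (I ℕ.+ J) I+J+K≡0)) ,
                          ∣∣²≡0 j (ℕP.m+n≡0⇒n≡0 I (ℕP.m+n≡0⇒m≡0 (I ℕ.+ J) I+J+K≡0)) ,
                          ∣∣²≡0 k (ℕP.m+n≡0⇒n≡0 (I ℕ.+ J) I+J+K≡0)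
    where
    ∣_∣² : ℤ → ℕ
    ∣ x ∣² = ℤ.∣ x ∣ ℕ.* ℤ.∣ x ∣
    ∣∣²≡0 : ∀ x → ∣ x ∣² ≡ 0 → x ≡ 0ℤ
    ∣∣²≡0 x x²≡0 = ℤP.∣i∣≡0⇒i≡0 (reduce (ℕP.m*n≡0⇒m≡0∨n≡0 ℤ.∣ x ∣ x²≡0))
    I J K : ℕ
    I = ∣ i ∣²
    J = ∣ j ∣²
    K = ∣ k ∣²
    I+J+K≡0 : I ℕ.+ J ℕ.+ K ≡ 0
    I+J+K≡0 = ℤP.+-injective (trans (sym (cong₂ ℤ._+_ (cong₂ ℤ._+_ (*-self i) (*-self j)) (*-self k))) sum≡0)

  negNorm-squares : ∀ x y z → let e = (y ℤ.- x) ℤ.* (x ℤ.- z) ℤ.- (z ℤ.- y) ℤ.* (z ℤ.- y) in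
                    ℤ.- (e ℤ.+ e) ≡ (x ℤ.- z) ℤ.* (x ℤ.- z) ℤ.+ (y ℤ.- x) ℤ.* (y ℤ.- x) ℤ.+ (z ℤ.- y) ℤ.* (z ℤ.- y)
  negNorm-squares = solve-∀

  negNorm≡0⇒equal : ∀ x y z → negNorm x y z ≡ 0ℤ → x ≡ y × y ≡ z
  negNorm≡0⇒equal x y z e≡0 = sym (ℤP.i-j≡0⇒i≡j y x (proj₁ (proj₂ differences≡0))) , sym (ℤP.i-j≡0⇒i≡j z y (proj₂ (proj₂ differences≡0)))
    where
    differences≡0 : x ℤ.- z ≡ 0ℤ × y ℤ.- x ≡ 0ℤ × z ℤ.- y ≡ 0ℤ
    differences≡0 = squares≡0 (x ℤ.- z) (y ℤ.- x) (z ℤ.- y) (trans (sym (negNorm-squares x y z)) (cong (λ e → ℤ.- (e ℤ.+ e)) e≡0))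

  rotation-combination : ∀ k (V : ℕ → ℤ) x →
    let a′ = V k ℤ.- V (2 ℕ.+ k); b′ = V (1 ℕ.+ k) ℤ.- V k; c′ = V (2 ℕ.+ k) ℤ.- V (1 ℕ.+ k)
        e = negNorm (V k) (V (1 ℕ.+ k)) (V (2 ℕ.+ k))
    in b′ ℤ.* block k a′ b′ c′ x ℤ.- c′ ℤ.* block k c′ a′ b′ x ≡ block k e (ℤ.- e) 0ℤ x
  rotation-combination k V x = trans (block-zipWith (λ s t → b′ ℤ.* s ℤ.- c′ ℤ.* t) f00≡0 k x)
                                     (cong₂ (λ e₂ e₃ → block k e e₂ e₃ x) (second≡-e X Y Z) (third≡0 X Y Z))
    where
    X Y Z b′ c′ e : ℤ
    X = V k
    Y = V (1 ℕ.+ k)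
    Z = V (2 ℕ.+ k)
    b′ = Y ℤ.- X
    c′ = Z ℤ.- Y
    e = negNorm X Y Z
    f00≡0 : b′ ℤ.* 0ℤ ℤ.- c′ ℤ.* 0ℤ ≡ 0ℤ
    f00≡0 = cong₂ (λ s t → s ℤ.- t) (ℤP.*-zeroʳ b′) (ℤP.*-zeroʳ c′)
    second≡-e : ∀ x y z → (y ℤ.- x) ℤ.* (y ℤ.- x) ℤ.- (z ℤ.- y) ℤ.* (x ℤ.- z) ≡ ℤ.- ((y ℤ.- x) ℤ.* (x ℤ.- z) ℤ.- (z ℤ.- y) ℤ.* (z ℤ.- y))
    second≡-e = solve-∀
    third≡0 : ∀ x y z → (y ℤ.- x) ℤ.* (z ℤ.- y) ℤ.- (z ℤ.- y) ℤ.* (y ℤ.- x) ≡ 0ℤ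
    third≡0 = solve-∀

  difference-in-block : ∀ {m} (V : ℕ → ℤ) (p : Fin (2 ℕ.+ m)) → V (toℕ p) ≢ V (suc (toℕ p)) →
                        ∃[ i ] negNorm (V (toℕ {suc m} i)) (V (1 ℕ.+ toℕ i)) (V (2 ℕ.+ toℕ i)) ≢ 0ℤ
  difference-in-block V zero    V₀≢V₁     = zero , V₀≢V₁ ∘ proj₁ ∘ negNorm≡0⇒equal _ _ _
  difference-in-block V (suc i) Vᵢ₊₁≢Vᵢ₊₂ = i , Vᵢ₊₁≢Vᵢ₊₂ ∘ proj₂ ∘ negNorm≡0⇒equal _ _ _

open ExponentVectors

module Extension {c ℓ} (E : ExtensionOfℚ c ℓ) where
  open ExtensionOfℚ E public hiding (zero)
  open import Relation.Binary.Reasoning.Setoid setoid public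
  open RingMorphisms.IsRingHomomorphism ι-hom public using (0#-homo; 1#-homo; +-homo; *-homo; -‿homo; ⟦⟧-cong)
  -- The solver takes its coefficients from ℚ through ι, whose decidable equality lets it cancel terms.
  private
    ACR : AlmostCommutativeRing c ℓ
    ACR = fromCommutativeRing commutativeRing
    module Exp = CommutativeSemiringExp commutativeSemiring
    ι-morphism : CommutativeRing.rawRing ℚP.+-*-commutativeRing -Raw-AlmostCommutative⟶ ACR
    ι-morphism = record { ⟦_⟧ = ι ; +-homo = +-homo ; *-homo = *-homo ; -‿homo = -‿homo ; 0-homo = 0#-homo ; 1-homo = 1#-homo }
    ι-decide : WeaklyDecidable (Induced-equivalence ι-morphism)
    ι-decide p q = Maybe.map ⟦⟧-cong (dec⇒maybe (p ℚ.≟ q))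
  open RingSolver (CommutativeRing.rawRing ℚP.+-*-commutativeRing) ACR ι-morphism ι-decide public
    using (solve; _:=_; _:+_; _:*_; _:-_; :-_)

  NonZero : Carrier → Set ℓ
  NonZero x = ¬ (x ≈ 0#)

  infixr 8 _^_ _^ℤ_
  _^_ : Carrier → ℕ → Carrier
  _^_ = _^ⁿ_ E

  _^ℤ_ : Carrier → ℤ → Carrier
  _^ℤ_ = _^ᶻ_ E

  ^≡Exp^ : ∀ x n → x ^ n ≡ x Exp.^ n
  ^≡Exp^ x zero    = ≡.refl
  ^≡Exp^ x (suc n) = ≡.cong (x *_) (^≡Exp^ x n)

  ^-congˡ : ∀ n {x y} → x ≈ y → x ^ n ≈ y ^ n
  ^-congˡ n {x} {y} x≈y rewrite ^≡Exp^ x n | ^≡Exp^ y n = Exp.^-congˡ n x≈y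

  ^-homo-* : ∀ x m n → x ^ (m ℕ.+ n) ≈ x ^ m * x ^ n
  ^-homo-* x m n rewrite ^≡Exp^ x (m ℕ.+ n) | ^≡Exp^ x m | ^≡Exp^ x n = Exp.^-homo-* x m n

  ^-assocʳ : ∀ x m n → (x ^ m) ^ n ≈ x ^ (m ℕ.* n)
  ^-assocʳ x m n rewrite ^≡Exp^ (x ^ m) n | ^≡Exp^ x m | ^≡Exp^ x (m ℕ.* n) = Exp.^-assocʳ x m n

  ^-distrib-* : ∀ x y n → (x * y) ^ n ≈ x ^ n * y ^ n
  ^-distrib-* x y n rewrite ^≡Exp^ (x * y) n | ^≡Exp^ x n | ^≡Exp^ y n = Exp.^-distrib-* x y n

  1^n≈1 : ∀ n → 1# ^ n ≈ 1#
  1^n≈1 zero    = refl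
  1^n≈1 (suc n) = trans (*-identityˡ _) (1^n≈1 n)

  ⁻¹-inverseˡ : ∀ {x} → NonZero x → x ⁻¹ * x ≈ 1#
  ⁻¹-inverseˡ {x} x≉0 = trans (*-comm _ _) (⁻¹-inverse x x≉0)

  *-cancelˡ : ∀ {x y z} → NonZero x → x * y ≈ x * z → y ≈ z
  *-cancelˡ {x} {y} {z} x≉0 xy≈xz = begin
    y               ≈⟨ *-identityˡ y ⟨
    1# * y          ≈⟨ *-congʳ (⁻¹-inverseˡ x≉0) ⟨
    (x ⁻¹ * x) * y  ≈⟨ *-assoc _ _ _ ⟩
    x ⁻¹ * (x * y)  ≈⟨ *-congˡ xy≈xz ⟩
    x ⁻¹ * (x * z)  ≈⟨ *-assoc _ _ _ ⟨
    (x ⁻¹ * x) * z  ≈⟨ *-congʳ (⁻¹-inverseˡ x≉0) ⟩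
    1# * z          ≈⟨ *-identityˡ z ⟩
    z               ∎

  1≉0 : NonZero 1#
  1≉0 = 0≉1 ∘ sym

  *-nonZero : ∀ {x y} → NonZero x → NonZero y → NonZero (x * y)
  *-nonZero {x} x≉0 y≉0 xy≈0 = y≉0 (*-cancelˡ x≉0 (trans xy≈0 (sym (zeroʳ x))))

  ^-nonZero : ∀ {x} n → NonZero x → NonZero (x ^ n)
  ^-nonZero zero    x≉0 = 1≉0
  ^-nonZero (suc n) x≉0 = *-nonZero x≉0 (^-nonZero n x≉0)

  ⁻¹-unique : ∀ {x y} → NonZero x → x * y ≈ 1# → y ≈ x ⁻¹
  ⁻¹-unique {x} x≉0 xy≈1 = *-cancelˡ x≉0 (trans xy≈1 (sym (⁻¹-inverse x x≉0)))

  ⁻¹-nonZero : ∀ {x} → NonZero x → NonZero (x ⁻¹)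
  ⁻¹-nonZero {x} x≉0 x⁻¹≈0 = 0≉1 (begin
    0#         ≈⟨ zeroʳ x ⟨
    x * 0#     ≈⟨ *-congˡ x⁻¹≈0 ⟨
    x * x ⁻¹   ≈⟨ ⁻¹-inverse x x≉0 ⟩
    1#         ∎)

  ⁻¹-cong : ∀ {x y} → NonZero x → x ≈ y → x ⁻¹ ≈ y ⁻¹
  ⁻¹-cong {x} x≉0 x≈y = ⁻¹-unique (x≉0 ∘ trans x≈y) (trans (*-congʳ (sym x≈y)) (⁻¹-inverse x x≉0))

  ⁻¹-distrib-* : ∀ {x y} → NonZero x → NonZero y → (x * y) ⁻¹ ≈ x ⁻¹ * y ⁻¹
  ⁻¹-distrib-* {x} {y} x≉0 y≉0 = sym (⁻¹-unique (*-nonZero x≉0 y≉0) (begin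
    (x * y) * (x ⁻¹ * y ⁻¹)  ≈⟨ solve 4 (λ x y x′ y′ → (x :* y) :* (x′ :* y′) := (x :* x′) :* (y :* y′)) refl x y (x ⁻¹) (y ⁻¹) ⟩
    (x * x ⁻¹) * (y * y ⁻¹)  ≈⟨ *-cong (⁻¹-inverse x x≉0) (⁻¹-inverse y y≉0) ⟩
    1# * 1#                  ≈⟨ *-identityˡ 1# ⟩
    1#                       ∎))

  1⁻¹≈1 : 1# ⁻¹ ≈ 1#
  1⁻¹≈1 = sym (⁻¹-unique 1≉0 (*-identityˡ 1#))

  ^ℤ-nonZero : ∀ {x} a → NonZero x → NonZero (x ^ℤ a)
  ^ℤ-nonZero (+ n)    x≉0 = ^-nonZero n x≉0
  ^ℤ-nonZero -[1+ n ] x≉0 = ⁻¹-nonZero (^-nonZero (suc n) x≉0)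

  ^ℤ-congˡ : ∀ {x y} a → NonZero x → x ≈ y → x ^ℤ a ≈ y ^ℤ a
  ^ℤ-congˡ (+ n)    x≉0 x≈y = ^-congˡ n x≈y
  ^ℤ-congˡ -[1+ n ] x≉0 x≈y = ⁻¹-cong (^-nonZero (suc n) x≉0) (^-congˡ (suc n) x≈y)

  ^ℤ-⊖ : ∀ {x} m n → NonZero x → x ^ℤ (m ⊖ n) ≈ x ^ m * (x ^ n) ⁻¹
  ^ℤ-⊖ {x} m       zero    x≉0 = sym (trans (*-congˡ 1⁻¹≈1) (*-identityʳ _))
  ^ℤ-⊖ {x} zero    (suc n) x≉0 = sym (*-identityˡ _)
  ^ℤ-⊖ {x} (suc m) (suc n) x≉0 rewrite ℤP.[1+m]⊖[1+n]≡m⊖n m n = begin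
    x ^ℤ (m ⊖ n)                          ≈⟨ ^ℤ-⊖ m n x≉0 ⟩
    x ^ m * (x ^ n) ⁻¹                    ≈⟨ *-identityˡ _ ⟨
    1# * (x ^ m * (x ^ n) ⁻¹)             ≈⟨ *-congʳ (⁻¹-inverse x x≉0) ⟨
    (x * x ⁻¹) * (x ^ m * (x ^ n) ⁻¹)     ≈⟨ solve 4 (λ x x′ a b → (x :* x′) :* (a :* b) := (x :* a) :* (x′ :* b)) refl x (x ⁻¹) (x ^ m) ((x ^ n) ⁻¹) ⟩
    (x * x ^ m) * (x ⁻¹ * (x ^ n) ⁻¹)     ≈⟨ *-congˡ (⁻¹-distrib-* x≉0 (^-nonZero n x≉0)) ⟨
    x ^ suc m * (x ^ suc n) ⁻¹            ∎

  ^ℤ-homo-* : ∀ {x} a b → NonZero x → x ^ℤ (a ℤ.+ b) ≈ x ^ℤ a * x ^ℤ b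
  ^ℤ-homo-* {x} (+ m)    (+ n)    x≉0 = ^-homo-* x m n
  ^ℤ-homo-* {x} (+ m)    -[1+ n ] x≉0 = ^ℤ-⊖ m (suc n) x≉0
  ^ℤ-homo-* {x} -[1+ m ] (+ n)    x≉0 = trans (^ℤ-⊖ n (suc m) x≉0) (*-comm _ _)
  ^ℤ-homo-* {x} -[1+ m ] -[1+ n ] x≉0 = begin
    (x ^ suc (suc (m ℕ.+ n))) ⁻¹          ≡⟨ ≡.cong (λ k → (x ^ suc k) ⁻¹) (ℕP.+-suc m n) ⟨
    (x ^ (suc m ℕ.+ suc n)) ⁻¹            ≈⟨ ⁻¹-cong (^-nonZero (suc m ℕ.+ suc n) x≉0) (^-homo-* x (suc m) (suc n)) ⟩
    (x ^ suc m * x ^ suc n) ⁻¹            ≈⟨ ⁻¹-distrib-* (^-nonZero (suc m) x≉0) (^-nonZero (suc n) x≉0) ⟩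
    (x ^ suc m) ⁻¹ * (x ^ suc n) ⁻¹       ∎

  open GroupProperties +-group public using () renaming (inverseˡ-unique to +-inverseˡ-unique; x∙y⁻¹≈ε⇒x≈y to x-y≈0⇒x≈y)
  open SemiringSum semiring public using (*-distribˡ-sum) renaming (sum to ∑; sum-cong-≋ to ∑-cong)
  open CommutativeMonoidSum *-commutativeMonoid public using ()
    renaming (sum to ∏; sum-cong-≋ to ∏-cong; ∑-distrib-+ to ∏-distrib-*;
              sum-replicate-zero to ∏-1; sum-permute to ∏-permute)

  RootOfUnity : ℕ → Carrier → Set ℓ
  RootOfUnity m x = x ^ m ≈ 1#

  rootOfUnity-cong : ∀ {m x y} → x ≈ y → RootOfUnity m x → RootOfUnity m y
  rootOfUnity-cong {m} x≈y xᵐ≈1 = trans (^-congˡ m (sym x≈y)) xᵐ≈1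

  *-rootOfUnity : ∀ {m x y} → RootOfUnity m x → RootOfUnity m y → RootOfUnity m (x * y)
  *-rootOfUnity {m} {x} {y} xᵐ≈1 yᵐ≈1 = begin
    (x * y) ^ m    ≈⟨ ^-distrib-* x y m ⟩
    x ^ m * y ^ m  ≈⟨ *-cong xᵐ≈1 yᵐ≈1 ⟩
    1# * 1#        ≈⟨ *-identityˡ 1# ⟩
    1#             ∎

  rootOfUnity-inverse : ∀ {m x y} → x * y ≈ 1# → RootOfUnity m x → RootOfUnity m y
  rootOfUnity-inverse {m} {x} {y} xy≈1 xᵐ≈1 = begin
    y ^ m          ≈⟨ *-identityˡ _ ⟨
    1# * y ^ m     ≈⟨ *-congʳ xᵐ≈1 ⟨
    x ^ m * y ^ m  ≈⟨ ^-distrib-* x y m ⟨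
    (x * y) ^ m    ≈⟨ rootOfUnity-cong {m} (sym xy≈1) (1^n≈1 m) ⟩
    1#             ∎

  rootOfUnity-ratio : ∀ {m x y} → NonZero y → RootOfUnity m (x * y ⁻¹) → x ^ m ≈ y ^ m
  rootOfUnity-ratio {m} {x} {y} y≉0 ratioᵐ≈1 = begin
    x ^ m                     ≈⟨ *-identityʳ _ ⟨
    x ^ m * 1#                ≈⟨ *-congˡ (rootOfUnity-cong {m} (sym (⁻¹-inverseˡ y≉0)) (1^n≈1 m)) ⟨
    x ^ m * (y ⁻¹ * y) ^ m    ≈⟨ *-congˡ (^-distrib-* (y ⁻¹) y m) ⟩
    x ^ m * (y ⁻¹ ^ m * y ^ m)  ≈⟨ *-assoc _ _ _ ⟨
    (x ^ m * y ⁻¹ ^ m) * y ^ m  ≈⟨ *-congʳ (^-distrib-* x (y ⁻¹) m) ⟨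
    (x * y ⁻¹) ^ m * y ^ m    ≈⟨ *-congʳ ratioᵐ≈1 ⟩
    1# * y ^ m                ≈⟨ *-identityˡ _ ⟩
    y ^ m                     ∎

  module ExponentLattice {n} (βs : Fin n → Carrier) (βs≉0 : ∀ i → NonZero (βs i)) (order : ℕ) where

    monomial : (ℕ → ℤ) → Carrier
    monomial W = ∏ (λ i → βs i ^ℤ W (toℕ i))

    prodPow≈monomial : ∀ v → prodPow E n βs v ≈ monomial (extend v)
    prodPow≈monomial v = trans (reflexive (foldr-tabulate≡sum *-monoid (λ i → βs i ^ℤ v i) (λ i → i)))
                               (∏-cong λ i → reflexive (≡.cong (βs i ^ℤ_) (≡.sym (extend-toℕ v i))))

    record Λ (W : ℕ → ℤ) : Set ℓ where
      constructor mkΛ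
      field rootOfUnity : RootOfUnity order (monomial W)

    Λ-cong : ∀ {W W′} → (∀ x → W x ≡ W′ x) → Λ W → Λ W′
    Λ-cong W≗W′ (mkΛ ΛW) = mkΛ (rootOfUnity-cong {order} (∏-cong λ i → reflexive (≡.cong (βs i ^ℤ_) (W≗W′ (toℕ i)))) ΛW)

    monomial-+ : ∀ W W′ → monomial (λ x → W x ℤ.+ W′ x) ≈ monomial W * monomial W′
    monomial-+ W W′ = trans (∏-cong λ i → ^ℤ-homo-* (W (toℕ i)) (W′ (toℕ i)) (βs≉0 i))
                             (∏-distrib-* (λ i → βs i ^ℤ W (toℕ i)) (λ i → βs i ^ℤ W′ (toℕ i)))

    Λ-+ : ∀ {W W′} → Λ W → Λ W′ → Λ (λ x → W x ℤ.+ W′ x)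
    Λ-+ {W} {W′} (mkΛ ΛW) (mkΛ ΛW′) = mkΛ (rootOfUnity-cong {order} (sym (monomial-+ W W′)) (*-rootOfUnity {order} ΛW ΛW′))

    Λ-neg : ∀ {W} → Λ W → Λ (λ x → ℤ.- W x)
    Λ-neg {W} (mkΛ ΛW) = mkΛ (rootOfUnity-inverse {order} (begin
      monomial W * monomial (λ x → ℤ.- W x)  ≈⟨ monomial-+ W (λ x → ℤ.- W x) ⟨
      monomial (λ x → W x ℤ.- W x)          ≈⟨ ∏-cong (λ i → reflexive (≡.cong (βs i ^ℤ_) (ℤP.+-inverseʳ (W (toℕ i))))) ⟩
      ∏ {n} (λ _ → 1#)                       ≈⟨ ∏-1 n ⟩
      1#                                     ∎) ΛW)

    Λ-scale-ℕ : ∀ k {W} → Λ W → Λ (λ x → + k ℤ.* W x)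
    Λ-scale-ℕ zero        ΛW = mkΛ (rootOfUnity-cong {order} (sym (∏-1 n)) (1^n≈1 order))
    Λ-scale-ℕ (suc k) {W} ΛW = Λ-cong (λ x → ≡.sym (ℤP.suc-* (+ k) (W x))) (Λ-+ ΛW (Λ-scale-ℕ k ΛW))

    Λ-scale : ∀ a {W} → Λ W → Λ (λ x → a ℤ.* W x)
    Λ-scale (+ k)    ΛW = Λ-scale-ℕ k ΛW
    Λ-scale -[1+ k ] {W} ΛW = Λ-cong (λ x → ℤP.neg-distribˡ-* (+ suc k) (W x)) (Λ-neg (Λ-scale-ℕ (suc k) ΛW))

  module Automorphism {n} {βs : Fin n → Carrier}
           {φ : Σ Carrier (InGenSubfield E βs) → Σ Carrier (InGenSubfield E βs)}
           (isAutomorphism : IsAutomorphismOfGenSubfield E βs φ) where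
    open IsAutomorphismOfGenSubfield isAutomorphism

    _∈L : Carrier → Set (c ⊔ ℓ)
    x ∈L = InGenSubfield E βs x

    Φ : ∀ x → x ∈L → Carrier
    Φ x x∈L = proj₁ (φ (x , x∈L))

    Φ-cong : ∀ {x y} {x∈L : x ∈L} {y∈L : y ∈L} → x ≈ y → Φ x x∈L ≈ Φ y y∈L
    Φ-cong {x} {y} {x∈L} {y∈L} = φ-cong (x , x∈L) (y , y∈L)

    0∈L : 0# ∈L
    0∈L = resp 0#-homo (base ℚ.0ℚ)

    1∈L : 1# ∈L
    1∈L = resp 1#-homo (base ℚ.1ℚ)

    Φ-1 : ∀ {1∈L′ : 1# ∈L} → Φ 1# 1∈L′ ≈ 1#
    Φ-1 = trans (Φ-cong refl) φ-1

    Φ-* : ∀ {x y} (x∈L : x ∈L) (y∈L : y ∈L) {xy∈L : (x * y) ∈L} → Φ (x * y) xy∈L ≈ Φ x x∈L * Φ y y∈L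
    Φ-* {x} {y} x∈L y∈L = trans (Φ-cong refl) (φ-* (x , x∈L) (y , y∈L))

    Φ-0 : ∀ {0∈L′ : 0# ∈L} → Φ 0# 0∈L′ ≈ 0#
    Φ-0 {0∈L′} = begin
      Φ0                       ≈⟨ solve 1 (λ a → a := (a :+ a) :- a) refl Φ0 ⟩
      (Φ0 + Φ0) - Φ0           ≈⟨ +-congʳ (φ-+ (0# , 0∈L′) (0# , 0∈L′)) ⟨
      Φ (0# + 0#) (plus 0∈L′ 0∈L′) - Φ0  ≈⟨ +-congʳ (Φ-cong (+-identityˡ 0#)) ⟩
      Φ0 - Φ0                  ≈⟨ -‿inverseʳ Φ0 ⟩
      0#                       ∎
      where
      Φ0 : Carrier
      Φ0 = Φ 0# 0∈L′

    Φ-nonZero : ∀ {x} (x∈L : x ∈L) → NonZero x → NonZero (Φ x x∈L)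
    Φ-nonZero {x} x∈L x≉0 Φx≈0 = x≉0 (φ-inj (x , x∈L) (0# , 0∈L) (trans Φx≈0 (sym Φ-0)))

    ^-∈L : ∀ {x} → x ∈L → ∀ k → (x ^ k) ∈L
    ^-∈L x∈L zero    = 1∈L
    ^-∈L x∈L (suc k) = times x∈L (^-∈L x∈L k)

    ^ℤ-∈L : ∀ {x} → x ∈L → NonZero x → ∀ a → (x ^ℤ a) ∈L
    ^ℤ-∈L x∈L x≉0 (+ k)    = ^-∈L x∈L k
    ^ℤ-∈L x∈L x≉0 -[1+ k ] = inv (^-∈L x∈L (suc k)) (^-nonZero (suc k) x≉0)

    ∏-∈L : ∀ {k} (f : Fin k → Carrier) → (∀ i → f i ∈L) → ∏ f ∈L
    ∏-∈L {zero}  f f∈L = 1∈L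
    ∏-∈L {suc k} f f∈L = times (f∈L zero) (∏-∈L (f ∘ suc) (f∈L ∘ suc))

    Φ-^ : ∀ {x} (x∈L : x ∈L) k {xᵏ∈L : (x ^ k) ∈L} → Φ (x ^ k) xᵏ∈L ≈ Φ x x∈L ^ k
    Φ-^ x∈L zero    = Φ-1
    Φ-^ x∈L (suc k) = trans (Φ-* x∈L (^-∈L x∈L k)) (*-congˡ (Φ-^ x∈L k))

    Φ-⁻¹ : ∀ {x} (x∈L : x ∈L) (x≉0 : NonZero x) {x⁻¹∈L : (x ⁻¹) ∈L} → Φ (x ⁻¹) x⁻¹∈L ≈ Φ x x∈L ⁻¹
    Φ-⁻¹ {x} x∈L x≉0 {x⁻¹∈L} = ⁻¹-unique (Φ-nonZero x∈L x≉0)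
      (trans (sym (Φ-* x∈L x⁻¹∈L {times x∈L x⁻¹∈L})) (trans (Φ-cong {y∈L = 1∈L} (⁻¹-inverse x x≉0)) Φ-1))

    Φ-^ℤ : ∀ {x} (x∈L : x ∈L) (x≉0 : NonZero x) a {xᵃ∈L : (x ^ℤ a) ∈L} → Φ (x ^ℤ a) xᵃ∈L ≈ Φ x x∈L ^ℤ a
    Φ-^ℤ x∈L x≉0 (+ k)    = Φ-^ x∈L k
    Φ-^ℤ x∈L x≉0 -[1+ k ] = trans (Φ-⁻¹ (^-∈L x∈L (suc k)) (^-nonZero (suc k) x≉0))
                                  (⁻¹-cong (Φ-nonZero (^-∈L x∈L (suc k)) (^-nonZero (suc k) x≉0)) (Φ-^ x∈L (suc k)))

    Φ-∏ : ∀ {k} (f : Fin k → Carrier) (f∈L : ∀ i → f i ∈L) {∏f∈L : ∏ f ∈L} → Φ (∏ f) ∏f∈L ≈ ∏ (λ i → Φ (f i) (f∈L i))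
    Φ-∏ {zero}  f f∈L = Φ-1
    Φ-∏ {suc k} f f∈L = trans (Φ-* (f∈L zero) (∏-∈L (f ∘ suc) (f∈L ∘ suc))) (*-congˡ (Φ-∏ (f ∘ suc) (f∈L ∘ suc)))

    Φ-rootOfUnity : ∀ {m x} (x∈L : x ∈L) → RootOfUnity m x → RootOfUnity m (Φ x x∈L)
    Φ-rootOfUnity {m} x∈L xᵐ≈1 = trans (sym (Φ-^ x∈L m {^-∈L x∈L m})) (trans (Φ-cong {y∈L = 1∈L} xᵐ≈1) Φ-1)

  horner : ∀ {n} → (Fin n → Carrier) → Carrier → Carrier
  horner {zero}  h x = 0#
  horner {suc n} h x = head h + x * horner (tail h) x

  horner-cong : ∀ {n} {h h′ : Fin n → Carrier} → (∀ i → h i ≈ h′ i) → ∀ x → horner h x ≈ horner h′ x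
  horner-cong {zero}  h≈h′ x = refl
  horner-cong {suc n} h≈h′ x = +-cong (h≈h′ zero) (*-congˡ (horner-cong (h≈h′ ∘ suc) x))

  horner-0 : ∀ {n} (h : Fin n → Carrier) → (∀ i → h i ≈ 0#) → ∀ x → horner h x ≈ 0#
  horner-0 {zero}  h h≈0 x = refl
  horner-0 {suc n} h h≈0 x = begin
    head h + x * horner (tail h) x  ≈⟨ +-cong (h≈0 zero) (*-congˡ (horner-0 (tail h) (h≈0 ∘ suc) x)) ⟩
    0# + x * 0#                     ≈⟨ trans (+-identityˡ _) (zeroʳ x) ⟩
    0#                              ∎

  ∑-horner : ∀ {n} (h : Fin n → Carrier) x → ∑ (λ i → h i * x ^ toℕ i) ≈ horner h x
  ∑-horner {zero}  h x = refl
  ∑-horner {suc n} h x = +-cong (*-identityʳ (h zero)) (begin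
    ∑ (λ i → h (suc i) * (x * x ^ toℕ i))  ≈⟨ ∑-cong (λ i → solve 3 (λ a x b → a :* (x :* b) := x :* (a :* b)) refl (h (suc i)) x (x ^ toℕ i)) ⟩
    ∑ (λ i → x * (h (suc i) * x ^ toℕ i))  ≈⟨ *-distribˡ-sum x (λ i → h (suc i) * x ^ toℕ i) ⟨
    x * ∑ (λ i → h (suc i) * x ^ toℕ i)    ≈⟨ *-congˡ (∑-horner (tail h) x) ⟩
    x * horner (tail h) x                   ∎)

  evalMonic≈ : ∀ n (a : Fin n → ℚ) x → evalMonic E n a x ≈ x ^ n + horner (ι ∘ a) x
  evalMonic≈ n a x = +-congˡ (trans (reflexive (foldr-tabulate≡sum +-monoid (λ i → ι (a i) * x ^ toℕ i) (λ i → i)))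
                                    (∑-horner (ι ∘ a) x))

  horner-init-last : ∀ {n} (h : Fin (suc n) → Carrier) x → horner h x ≈ horner (init h) x + last h * x ^ n
  horner-init-last {zero}  h x = begin
    head h + x * 0#  ≈⟨ trans (+-congˡ (zeroʳ x)) (+-identityʳ _) ⟩
    head h           ≈⟨ trans (+-identityˡ _) (*-identityʳ _) ⟨
    0# + head h * 1# ∎
  horner-init-last {suc n} h x = begin
    head h + x * horner (tail h) x                                 ≈⟨ +-congˡ (*-congˡ (horner-init-last (tail h) x)) ⟩
    head h + x * (horner (init (tail h)) x + last h * x ^ n)       ≈⟨ solve 5 (λ h₀ x p l xⁿ → h₀ :+ x :* (p :+ l :* xⁿ) := (h₀ :+ x :* p) :+ l :* (x :* xⁿ))
                                                                          refl (head h) x (horner (init (tail h)) x) (last h) (x ^ n) ⟩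
    (head h + x * horner (init (tail h)) x) + last h * (x * x ^ n) ∎

  *-horner : ∀ {n} (h : Fin (suc n) → Carrier) x → x * horner h x ≈ horner (0# ∷ init h) x + last h * x ^ suc n
  *-horner {n} h x = begin
    x * horner h x                                   ≈⟨ *-congˡ (horner-init-last h x) ⟩
    x * (horner (init h) x + last h * x ^ n)         ≈⟨ solve 4 (λ x p l xⁿ → x :* (p :+ l :* xⁿ) := x :* p :+ l :* (x :* xⁿ))
                                                             refl x (horner (init h) x) (last h) (x ^ n) ⟩
    x * horner (init h) x + last h * x ^ suc n       ≈⟨ +-congʳ (+-identityˡ _) ⟨
    horner (0# ∷ init h) x + last h * x ^ suc n      ∎

  horner-linear : ∀ {n} (p q : Fin n → Carrier) c x → horner (λ i → p i - c * q i) x ≈ horner p x - c * horner q x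
  horner-linear {zero}  p q c x = sym (trans (+-congˡ (-‿cong (zeroʳ c))) (-‿inverseʳ 0#))
  horner-linear {suc n} p q c x = begin
    (head p - c * head q) + x * horner (λ i → tail p i - c * tail q i) x   ≈⟨ +-congˡ (*-congˡ (horner-linear (tail p) (tail q) c x)) ⟩
    (head p - c * head q) + x * (horner (tail p) x - c * horner (tail q) x) ≈⟨ solve 6 (λ p₀ c q₀ x P Q → (p₀ :- c :* q₀) :+ x :* (P :- c :* Q) := (p₀ :+ x :* P) :- c :* (q₀ :+ x :* Q))
                                                                                 refl (head p) c (head q) x (horner (tail p) x) (horner (tail q) x) ⟩
    horner p x - c * horner q x                                              ∎

  power-reduction : ∀ {n} (a : Fin (suc n) → ℚ) N →
                    ∃[ r ] (∀ x → x ^ suc n + horner (ι ∘ a) x ≈ 0# → x ^ N ≈ horner (ι ∘ r) x)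
  power-reduction {n} a zero = (ℚ.1ℚ ∷ λ _ → ℚ.0ℚ) , λ x _ → sym (begin
    ι ℚ.1ℚ + x * horner {n} (λ _ → ι ℚ.0ℚ) x  ≈⟨ +-cong 1#-homo (*-congˡ (horner-0 {n} (λ _ → ι ℚ.0ℚ) (λ _ → 0#-homo) x)) ⟩
    1# + x * 0#                                ≈⟨ trans (+-congˡ (zeroʳ x)) (+-identityʳ 1#) ⟩
    1#                                         ∎)
  power-reduction {n} a (suc N) with power-reduction a N
  ... | r , xᴺ≈r = r′ , λ x root → begin
    x * x ^ N                                                        ≈⟨ *-congˡ (xᴺ≈r x root) ⟩
    x * horner (ι ∘ r) x                                             ≈⟨ *-horner (ι ∘ r) x ⟩
    horner (0# ∷ init (ι ∘ r)) x + ι (last r) * x ^ suc n            ≈⟨ +-cong (horner-cong ι-shift x) (*-congˡ (+-inverseˡ-unique _ _ root)) ⟩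
    horner (ι ∘ shift) x + ι (last r) * - horner (ι ∘ a) x           ≈⟨ solve 3 (λ s l p → s :+ l :* (:- p) := s :- l :* p) refl _ _ _ ⟩
    horner (ι ∘ shift) x - ι (last r) * horner (ι ∘ a) x             ≈⟨ horner-linear (ι ∘ shift) (ι ∘ a) (ι (last r)) x ⟨
    horner (λ i → ι (shift i) - ι (last r) * ι (a i)) x              ≈⟨ horner-cong ι-linear x ⟨
    horner (ι ∘ r′) x                                                ∎
    where
    shift r′ : Fin (suc n) → ℚ
    shift = ℚ.0ℚ ∷ init r
    r′ i  = shift i ℚ.- last r ℚ.* a i
    ι-shift : ∀ i → (0# ∷ init (ι ∘ r)) i ≈ ι (shift i)
    ι-shift zero    = sym 0#-homo
    ι-shift (suc i) = refl
    ι-linear : ∀ i → ι (r′ i) ≈ ι (shift i) - ι (last r) * ι (a i)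
    ι-linear i = trans (+-homo _ _) (+-congˡ (trans (-‿homo _) (-‿cong (*-homo _ _))))

  quotient : ∀ {n} → (Fin (suc n) → Carrier) → Carrier → Fin n → Carrier
  quotient {suc n} h a zero    = horner (tail h) a
  quotient {suc n} h a (suc j) = quotient (tail h) a j

  horner-division : ∀ {n} (h : Fin (suc n) → Carrier) a x → horner h x ≈ horner h a + (x - a) * horner (quotient h a) x
  horner-division {zero}  h a x = begin
    head h + x * 0#                         ≈⟨ +-congˡ (zeroʳ x) ⟩
    head h + 0#                             ≈⟨ +-congˡ (zeroʳ (x - a)) ⟨
    head h + (x - a) * 0#                   ≈⟨ +-congʳ (trans (+-congˡ (zeroʳ a)) (+-identityʳ _)) ⟨
    (head h + a * 0#) + (x - a) * 0#        ∎
  horner-division {suc n} h a x = begin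
    head h + x * horner (tail h) x          ≈⟨ +-congˡ (*-congˡ (horner-division (tail h) a x)) ⟩
    head h + x * (hₐ + (x - a) * q)         ≈⟨ solve 5 (λ h₀ x a hₐ q → h₀ :+ x :* (hₐ :+ (x :- a) :* q) := (h₀ :+ a :* hₐ) :+ (x :- a) :* (hₐ :+ x :* q))
                                                     refl (head h) x a hₐ q ⟩
    (head h + a * hₐ) + (x - a) * (hₐ + x * q) ∎
    where
    hₐ q : Carrier
    hₐ = horner (tail h) a
    q  = horner (quotient (tail h) a) x

  horner-vanishing : ∀ {n} (h xs : Fin n → Carrier) → (∀ i j → xs i ≈ xs j → i ≡ j) →
                     (∀ i → horner h (xs i) ≈ 0#) → ∀ x → horner h x ≈ 0#
  horner-vanishing {zero}  h xs xs-distinct h[xs]≈0 x = refl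
  horner-vanishing {suc n} h xs xs-distinct h[xs]≈0 x = begin
    horner h x                                 ≈⟨ horner-division h a x ⟩
    horner h a + (x - a) * horner (quotient h a) x ≈⟨ +-cong (h[xs]≈0 zero) (*-congˡ (q≈0 x)) ⟩
    0# + (x - a) * 0#                          ≈⟨ trans (+-identityˡ _) (zeroʳ _) ⟩
    0#                                         ∎
    where
    a : Carrier
    a = xs zero
    q[xs]≈0 : ∀ i → horner (quotient h a) (xs (suc i)) ≈ 0#
    q[xs]≈0 i = *-cancelˡ d≉0 (begin
      d * horner (quotient h a) (xs (suc i))      ≈⟨ +-identityˡ _ ⟨
      0# + d * horner (quotient h a) (xs (suc i)) ≈⟨ +-congʳ (h[xs]≈0 zero) ⟨
      horner h a + d * horner (quotient h a) (xs (suc i)) ≈⟨ horner-division h a (xs (suc i)) ⟨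
      horner h (xs (suc i))                       ≈⟨ h[xs]≈0 (suc i) ⟩
      0#                                          ≈⟨ zeroʳ d ⟨
      d * 0#                                      ∎)
      where
      d : Carrier
      d = xs (suc i) - a
      d≉0 : NonZero d
      d≉0 d≈0 with xs-distinct (suc i) zero (x-y≈0⇒x≈y _ _ d≈0)
      ... | ()
    q≈0 : ∀ x → horner (quotient h a) x ≈ 0#
    q≈0 = horner-vanishing (quotient h a) (xs ∘ suc) (λ i j e → FinP.suc-injective (xs-distinct (suc i) (suc j) e)) q[xs]≈0

  common-power-rational : ∀ {n} (a : Fin (suc n) → ℚ) (xs : Fin (suc n) → Carrier) →
                          (∀ i j → xs i ≈ xs j → i ≡ j) → (∀ i → evalMonic E (suc n) a (xs i) ≈ 0#) →
                          ∀ N {C} → (∀ i → xs i ^ N ≈ C) → IsRational E C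
  common-power-rational {n} a xs xs-distinct xs-roots N {C} xsᴺ≈C = head r , sym (x-y≈0⇒x≈y _ _ (begin
    ι (head r) - C                 ≈⟨ trans (+-congˡ (zeroˡ _)) (+-identityʳ _) ⟨
    horner h 0#                    ≈⟨ horner-vanishing h xs xs-distinct h[xs]≈0 0# ⟩
    0#                             ∎))
    where
    reduction : ∃[ r ] (∀ x → x ^ suc n + horner (ι ∘ a) x ≈ 0# → x ^ N ≈ horner (ι ∘ r) x)
    reduction = power-reduction a N
    r : Fin (suc n) → ℚ
    r = proj₁ reduction
    h : Fin (suc n) → Carrier
    h = (ι (head r) - C) ∷ tail (ι ∘ r)
    h≈r-C : ∀ x → horner h x ≈ horner (ι ∘ r) x - C
    h≈r-C x = solve 3 (λ r₀ C p → (r₀ :- C) :+ p := (r₀ :+ p) :- C) refl (ι (head r)) C (x * horner (tail (ι ∘ r)) x)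
    h[xs]≈0 : ∀ i → horner h (xs i) ≈ 0#
    h[xs]≈0 i = begin
      horner h (xs i)               ≈⟨ h≈r-C (xs i) ⟩
      horner (ι ∘ r) (xs i) - C     ≈⟨ +-congʳ (proj₂ reduction (xs i) (trans (sym (evalMonic≈ (suc n) a (xs i))) (xs-roots i))) ⟨
      xs i ^ N - C                  ≈⟨ +-congʳ (xsᴺ≈C i) ⟩
      C - C                         ≈⟨ -‿inverseʳ C ⟩
      0#                            ∎

  ∏-block : ∀ {n} (βs : Fin (suc n) → Carrier) (p : Fin n) a b →
            ∏ (λ i → βs i ^ℤ block (toℕ p) a b 0ℤ (toℕ i)) ≈ βs (inject₁ p) ^ℤ a * βs (suc p) ^ℤ b
  ∏-block {suc n} βs zero    a b = *-congˡ (trans (*-congˡ (trans (∏-cong outside-block) (∏-1 n))) (*-identityʳ _))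
    where
    outside-block : ∀ i → βs (suc (suc i)) ^ℤ block 0 a b 0ℤ (suc (suc (toℕ i))) ≈ 1#
    outside-block zero    = refl
    outside-block (suc i) = refl
  ∏-block {suc n} βs (suc p) a b = trans (*-identityˡ _) (∏-block (βs ∘ suc) p a b)

  module Conjugates {m} (βs : Fin (3 ℕ.+ m) → Carrier)
                    (galois : ∀ σ → IsEven σ → InducedByAutomorphism E βs σ) where

    adjacent-conjugation : ∀ p → ∃[ φ ] (IsAutomorphismOfGenSubfield E βs φ ×
                                         proj₁ (φ (βs (inject₁ p) , gen (inject₁ p))) ≈ βs (suc p))
    adjacent-conjugation p with adjacent-even p
    ... | σ , σ-even , σp≡p+1 with galois σ σ-even
    ... | φ , aut , φβs≈ = φ , aut , trans (φβs≈ (inject₁ p)) (reflexive (≡.cong βs σp≡p+1))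

    βs-nonZero : ∀ {i} → NonZero (βs i) → ∀ j → NonZero (βs j)
    βs-nonZero {i} βsi≉0 j = adjacent-transport (NonZero ∘ βs) up down i j βsi≉0
      where
      up : ∀ p → NonZero (βs (inject₁ p)) → NonZero (βs (suc p))
      up p x≉0 with adjacent-conjugation p
      ... | φ , aut , Φx≈y = Φ-nonZero (gen _) x≉0 ∘ trans Φx≈y
        where open Automorphism aut
      down : ∀ p → NonZero (βs (suc p)) → NonZero (βs (inject₁ p))
      down p y≉0 x≈0 with adjacent-conjugation p
      ... | φ , aut , Φx≈y = y≉0 (trans (sym Φx≈y) (trans (Φ-cong {y∈L = 0∈L} x≈0) Φ-0))
        where open Automorphism aut

    module Relations (βs≉0 : ∀ i → NonZero (βs i)) (order : ℕ) where
      open ExponentLattice βs βs≉0 order public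

      Λ-unrotate : ∀ (i : Fin (suc m)) {W} → Λ W → Λ (W ∘ unrotate (toℕ i))
      Λ-unrotate i {W} (mkΛ ΛW) with galois (rotate₃ i) (rotate₃-even i)
      ... | φ , aut , φβs≈ = mkΛ (rootOfUnity-cong {order} image≈ (Φ-rootOfUnity {order} monomial∈L ΛW))
        where
        open Automorphism aut
        σ : Permutation′ (3 ℕ.+ m)
        σ = rotate₃ i
        G : Fin (3 ℕ.+ m) → Carrier
        G k = βs k ^ℤ W (unrotate (toℕ i) (toℕ k))
        factor∈L : ∀ j → (βs j ^ℤ W (toℕ j)) ∈L
        factor∈L j = ^ℤ-∈L (gen j) (βs≉0 j) (W (toℕ j))
        monomial∈L : monomial W ∈L
        monomial∈L = ∏-∈L _ factor∈L
        image≈ : Φ (monomial W) monomial∈L ≈ monomial (W ∘ unrotate (toℕ i))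
        image≈ = begin
          Φ (monomial W) monomial∈L                  ≈⟨ Φ-∏ _ factor∈L ⟩
          ∏ (λ j → Φ (βs j ^ℤ W (toℕ j)) (factor∈L j)) ≈⟨ ∏-cong (λ j → trans (Φ-^ℤ (gen j) (βs≉0 j) (W (toℕ j)) {factor∈L j})
                                                            (^ℤ-congˡ (W (toℕ j)) (Φ-nonZero (gen j) (βs≉0 j)) (φβs≈ j))) ⟩
          ∏ (λ j → βs (σ ⟨$⟩ʳ j) ^ℤ W (toℕ j))       ≈⟨ ∏-cong (λ j → reflexive (≡.cong (λ k → βs (σ ⟨$⟩ʳ j) ^ℤ W k)
                                                            (≡.trans (≡.cong toℕ (≡.sym (inverseˡ σ))) (toℕ-rotate₃⁻¹ i (σ ⟨$⟩ʳ j))))) ⟩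
          ∏ (λ j → G (σ ⟨$⟩ʳ j))                     ≈⟨ ∏-permute G σ ⟨
          ∏ G                                        ∎

      Λ-rotate-block : ∀ (i : Fin (suc m)) {a b c} → Λ (block (toℕ i) a b c) → Λ (block (toℕ i) c a b)
      Λ-rotate-block i {a} {b} {c} = Λ-cong (block-unrotate (toℕ i) a b c) ∘ Λ-unrotate i

      Λ-negNorm-block : ∀ (i : Fin (suc m)) {V} → Λ V →
                        let k = toℕ i; e = negNorm (V k) (V (1 ℕ.+ k)) (V (2 ℕ.+ k)) in Λ (block k e (ℤ.- e) 0ℤ)
      Λ-negNorm-block i {V} ΛV = Λ-cong (rotation-combination k V) (Λ-+ (Λ-scale b′ Λu) (Λ-neg (Λ-scale c′ (Λ-rotate-block i Λu))))
        where
        k : ℕ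
        k = toℕ i
        b′ c′ : ℤ
        b′ = V (1 ℕ.+ k) ℤ.- V k
        c′ = V (2 ℕ.+ k) ℤ.- V (1 ℕ.+ k)
        Λu : Λ (block k (V k ℤ.- V (2 ℕ.+ k)) b′ c′)
        Λu = Λ-cong (sub-unrotate≡block k V) (Λ-+ ΛV (Λ-neg (Λ-unrotate i ΛV)))

      Λ-positive-pair : ∀ k e → e ≢ 0ℤ → Λ (block k e (ℤ.- e) 0ℤ) → ∃[ D ] Λ (block k (+ suc D) -[1+ D ] 0ℤ)
      Λ-positive-pair k (+ zero)  e≢0 _  = contradiction ≡.refl e≢0
      Λ-positive-pair k (+ suc D) _   Λe = D , Λe
      Λ-positive-pair k -[1+ D ]  _   Λe = D , Λ-cong (block-zipWith (λ s _ → ℤ.- s) ≡.refl k {a′ = 0ℤ} {0ℤ} {0ℤ}) (Λ-neg Λe)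

      Λ-pair-everywhere : ∀ {d} (i : Fin (suc m)) → Λ (block (toℕ i) d (ℤ.- d) 0ℤ) →
                          ∀ (q : Fin (2 ℕ.+ m)) → Λ (block (toℕ q) d (ℤ.- d) 0ℤ)
      Λ-pair-everywhere {d} i Λᵢ q = adjacent-transport Q up down (inject₁ i) q (at-inject₁ i Λᵢ)
        where
        Q : Fin (2 ℕ.+ m) → Set ℓ
        Q p = Λ (block (toℕ p) d (ℤ.- d) 0ℤ)
        at-inject₁ : ∀ i → Λ (block (toℕ i) d (ℤ.- d) 0ℤ) → Q (inject₁ i)
        at-inject₁ i = ≡.subst (λ k → Λ (block k d (ℤ.- d) 0ℤ)) (≡.sym (FinP.toℕ-inject₁ i))
        up : ∀ i → Q (inject₁ i) → Q (suc i)
        up i = Λ-cong (block-suc (toℕ i) d (ℤ.- d)) ∘ Λ-rotate-block i ∘ ≡.subst (λ k → Λ (block k d (ℤ.- d) 0ℤ)) (FinP.toℕ-inject₁ i)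
        down : ∀ i → Q (suc i) → Q (inject₁ i)
        down i = at-inject₁ i ∘ Λ-rotate-block i ∘ Λ-rotate-block i ∘ Λ-cong (≡.sym ∘ block-suc (toℕ i) d (ℤ.- d))

      pair⇒equal-powers : ∀ D p → Λ (block (toℕ p) (+ suc D) -[1+ D ] 0ℤ) →
                          βs (inject₁ p) ^ (suc D ℕ.* order) ≈ βs (suc p) ^ (suc D ℕ.* order)
      pair⇒equal-powers D p (mkΛ Λp) = begin
        x ^ (suc D ℕ.* order)   ≈⟨ ^-assocʳ x (suc D) order ⟨
        (x ^ suc D) ^ order     ≈⟨ rootOfUnity-ratio {order} (^-nonZero (suc D) (βs≉0 (suc p))) (rootOfUnity-cong {order} (∏-block βs p _ _) Λp) ⟩
        (y ^ suc D) ^ order     ≈⟨ ^-assocʳ y (suc D) order ⟩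
        y ^ (suc D ℕ.* order)   ∎
        where
        x y : Carrier
        x = βs (inject₁ p)
        y = βs (suc p)

      nonconstant⇒equal-powers : ∀ {V} → Λ V → ∀ p → V (toℕ p) ≢ V (suc (toℕ p)) →
                                 ∃[ D ] ∀ i j → βs i ^ (suc D ℕ.* order) ≈ βs j ^ (suc D ℕ.* order)
      nonconstant⇒equal-powers {V} ΛV p Vₚ≢Vₚ₊₁ =
        D , λ i j → adjacent-transport (λ k → βs i ^ N ≈ βs k ^ N) (λ q eq → trans eq (adjacent q)) (λ q eq → trans eq (sym (adjacent q))) i j refl
        where
        b : Fin (suc m)
        b = proj₁ (difference-in-block V p Vₚ≢Vₚ₊₁)
        k : ℕ
        k = toℕ b
        positive-pair : ∃[ D ] Λ (block k (+ suc D) -[1+ D ] 0ℤ)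
        positive-pair = Λ-positive-pair k (negNorm (V k) (V (1 ℕ.+ k)) (V (2 ℕ.+ k)))
                                        (proj₂ (difference-in-block V p Vₚ≢Vₚ₊₁)) (Λ-negNorm-block b ΛV)
        D N : ℕ
        D = proj₁ positive-pair
        N = suc D ℕ.* order
        adjacent : ∀ q → βs (inject₁ q) ^ N ≈ βs (suc q) ^ N
        adjacent q = pair⇒equal-powers D q (Λ-pair-everywhere b (proj₂ positive-pair) q)

open ExtensionOfℚ using (Carrier; _≈_)

proposition3p1 : ∀ {c ℓ} (E : ExtensionOfℚ c ℓ) (n : ℕ) → 5 ≤ n →
    (a : Fin n → ℚ) (β : Carrier E) (βs : Fin n → Carrier E) →
    IsMinimalPolynomial E n a β →
    (∀ (k : ℤ) → k ≢ 0ℤ → ¬ IsRational E (_^ᶻ_ E β k)) →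
    (∀ i → _≈_ E (evalMonic E n a (βs i)) (ExtensionOfℚ.0# E)) →
    (∀ i j → _≈_ E (βs i) (βs j) → i ≡ j) →
    (∃[ i ] _≈_ E (βs i) β) →
    (∀ σ → IsEven σ → InducedByAutomorphism E βs σ) →
    ∀ (v : Fin n → ℤ) → (∃[ i ] ∃[ j ] (v i ≢ v j)) →
    ¬ IsRootOfUnity E (prodPow E n βs v)
proposition3p1 E (suc (suc (suc m))) (s≤s (s≤s (s≤s _))) a β βs _ β-irrational roots distinct (i₀ , βsᵢ₀≈β) galois
               v v-nonconstant (order , order≢0 , unity) =
  β-irrational (+ N) N≢0 (common-power-rational a βs distinct roots N βsᴺ≈βᴺ)
  where
  open Extension E hiding (Carrier; _≈_)
  open Conjugates βs galois
  β≉0 : NonZero β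
  β≉0 β≈0 = β-irrational (+ 1) (λ ()) (ℚ.0ℚ , trans (*-identityʳ β) (trans β≈0 (sym 0#-homo)))
  βs≉0 : ∀ i → NonZero (βs i)
  βs≉0 = βs-nonZero (β≉0 ∘ trans (sym βsᵢ₀≈β))
  open Relations βs≉0 order
  difference : ∃[ p ] v (inject₁ p) ≢ v (suc p)
  difference = adjacent-difference ℤP._≟_ v v-nonconstant
  equal-powers : ∃[ D ] ∀ i j → _≈_ E (βs i ^ (suc D ℕ.* order)) (βs j ^ (suc D ℕ.* order))
  equal-powers = nonconstant⇒equal-powers {extend v} (mkΛ (rootOfUnity-cong {order} (prodPow≈monomial v) unity))
                                          (proj₁ difference) (extend-adjacent v _ (proj₂ difference))
  N : ℕ
  N = suc (proj₁ equal-powers) ℕ.* order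
  N≢0 : + N ≢ 0ℤ
  N≢0 +N≡0 = [ (λ ()) , order≢0 ]′ (ℕP.m*n≡0⇒m≡0∨n≡0 (suc (proj₁ equal-powers)) (ℤP.+-injective +N≡0))
  βsᴺ≈βᴺ : ∀ i → _≈_ E (βs i ^ N) (β ^ N)
  βsᴺ≈βᴺ i = trans (proj₂ equal-powers i i₀) (^-congˡ N βsᵢ₀≈β)
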